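{- For all integers $d\ge k\ge 1$, $$A_d(x^k)=x^k\Big(1+2x+\sum_{m=1}^{d-k}(-1)^m C_m x^{m+1}\Big)=x^k\big(1+2x-x^2+2x^3-5x^4+14x^5-\cdots+(-1)^{d-k}C_{d-k}x^{d-k+1}\big),$$ where $C_m=\frac{1}{m+1}\binom{2m}{m}$ is the $m$-th Catalan number.
   Context: $G_n$ is the ladder graph with vertices $(j,0),(j,1)$, $0\le j\le n$, horizontal edges $(j,a)(j+1,a)$ and vertical edges $(j,0)(j,1)$, whose elementary regions are $n$ unit squares. $\mathcal{C}(G_n)$ is the cubical complex of its tilings (partitions of the vertex set into edges and vertex sets of unit squares), a tiling with exactly $k$ squares being a $k$-dimensional face; $F_n(x)=\sum_k f_kx^k$ with $f_k$ the number of $k$-dimensional faces, and $P_n(x)=F_n(x-1)$ (equivalently, the coefficient of $x^k$ in $P_n$ is $\binom{n+1-k}{k}$). Let $\mathcal{P}^d$ be the real vector space of polynomials of degree at most $d$; linear maps $A_d:\mathcal{P}^d\to\mathcal{P}^{d+1}$ are defined recursively by $A_d(x^k)=xA_{d-1}(x^{k-1})$ for $k>0$, $A_0(1)=1+2x$, and $A_d(1)=P_{2d+1}-A_d(P_{2d-1}-1)$ for $d\ge1$. -}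

module Defs where

open import Data.Nat using (ℕ; zero; suc; _+_; _*_; _∸_; _≡ᵇ_; _/_)
open import Data.Nat.Combinatorics using (_C_)
open import Data.Integer using (ℤ; +_; -_) renaming (_+_ to _+ℤ_; _*_ to _*ℤ_; _-_ to _-ℤ_)
open import Data.Bool using (if_then_else_)

-- Polynomials with real (here: integer) coefficients, represented by their
-- coefficient sequences: p i is the coefficient of x^i.
Poly : Set
Poly = ℕ → ℤ

0ₚ : Poly
0ₚ _ = + 0

X^ : ℕ → Poly
X^ k i = if i ≡ᵇ k then + 1 else + 0

_+ₚ_ : Poly → Poly → Poly
(p +ₚ q) i = p i +ℤ q i

_-ₚ_ : Poly → Poly → Poly
(p -ₚ q) i = p i -ℤ q i

_·ₚ_ : ℤ → Poly → Poly
(c ·ₚ p) i = c *ℤ p i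

xₚ* : Poly → Poly
xₚ* p zero = + 0
xₚ* p (suc i) = p i

x^_*ₚ_ : ℕ → Poly → Poly
x^ zero *ₚ p = p
x^ suc k *ₚ p = xₚ* (x^ k *ₚ p)

Σₚ : ℕ → (ℕ → Poly) → Poly
Σₚ zero f = 0ₚ
Σₚ (suc n) f = Σₚ n f +ₚ f n

P : ℕ → Poly
P n k = + ((n + 1 ∸ k) C k)

-- The linear maps A_d : P^d → P^{d+1}, determined by the images of the
-- monomials (Aimg d k = A_d(x^k), 0 ≤ k ≤ d) and extended linearly:
-- A d p = Σ_{j=0}^{d} p_j A_d(x^j).
mutual
  A : ℕ → Poly → Poly
  A d p = Σₚ (suc d) (λ j → p j ·ₚ Aimg d j)

  Aimg : ℕ → ℕ → Poly
  Aimg zero zero = X^ 0 +ₚ ((+ 2) ·ₚ X^ 1)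
  -- outside the domain (k > d = 0): irrelevant
  Aimg zero (suc k) = 0ₚ
  Aimg (suc d) (suc k) = xₚ* (A d (X^ k))
  -- A_d(1) = P_{2d+1} - A_d(P_{2d-1} - 1)   (here d+1 in place of d).
  -- q = P_{2d+1} - 1 has zero constant term, so by linearity and the rule
  -- A_{d+1}(x^j) = x A_d(x^{j-1}) (j ≥ 1) we get A_{d+1}(q) = x A_d(q / x).
  Aimg (suc d) zero =
    P (2 * (suc d) + 1) -ₚ xₚ* (A d (λ i → (P (2 * (suc d) ∸ 1) -ₚ X^ 0) (suc i)))

catalan : ℕ → ℕ
catalan m = ((2 * m) C m) / suc m

sgn : ℕ → ℤ
sgn zero = + 1
sgn (suc m) = - sgn m

rhs : ℕ → ℕ → Poly
rhs d k = x^ k *ₚ (X^ 0 +ₚ (((+ 2) ·ₚ X^ 1) +ₚ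
  Σₚ (d ∸ k) (λ j → (sgn (suc j) *ℤ (+ catalan (suc j))) ·ₚ X^ (suc (suc j)))))

-- A_d(x^k) = x^k A_{d-k}(1) straight from the recursion, so the point is that A_e(1) is the
-- truncation c_e = 1 + 2x + Σ_{m=1}^{e} (-1)^m C_m x^{m+1} of the series c = catalanSeries.
-- By strong induction A_e(x^j) = x^j c_{e-j} for j ≥ 1, and then in degrees ≤ e + 2 the relation
-- A_{e+1}(1) = P_{2e+3} - x A_e((P_{2e+1} - 1)/x) becomes the congruence
-- P_{n-1} · c ≡ P_{n+1} (mod x^{n+1}) for n = 2e + 2; in higher degrees both sides vanish.
-- The congruence follows by induction on n from P_{n+1} = P_n + x P_{n-1}, once it is extended to
-- all degrees: the discrepancy in degree n + s + 1 is (-1)^{n+s} times the ballot number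
-- binom(n+2s, s) - binom(n+2s, s-1). For n = 0, 1 this says that C_{s+1} equals both
-- binom(2s+2, s+1) - binom(2s+2, s) and binom(2s+1, s) - binom(2s+1, s-1).

module Submission where

open import Defs
open import Data.Nat using (ℕ; zero; suc; pred; _+_; _*_; _∸_; _/_; _≤_; _<_; z≤n; s≤s)
open import Data.Nat.Properties
  using (≤-refl; ≤-reflexive; ≤-trans; ≤-total; ≤-<-connex; <⇒≢; <-≤-trans; n≤1+n; m≤m+n; m≤n+m;
         m≤n⇒m≤1+n; m<n⇒m<1+n; m<1+n⇒m≤n; m≤n⇒m<n∨m≡n; +-comm; +-suc; +-mono-<; *-comm;
         *-cancelˡ-≤; *-monoˡ-≤; *-distribˡ-∸; +-∸-assoc; m+n∸m≡n; m+n∸n≡m; m∸n+n≡m; m+[n∸m]≡n;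
         m∸n≤m; m≤n⇒m∸n≡0; m<n+o⇒m∸n<o; pred[m∸n]≡m∸[1+n])
open import Data.Nat.Combinatorics
  using (_C_; nCk+nC[k+1]≡[n+1]C[k+1]; nCk≡nC[n∸k]; nC1≡n; k>n⇒nCk≡0)
open import Data.Nat.DivMod using (m*n/n≡m)
open import Data.Nat.Induction using (<-rec)
open import Data.Integer using (ℤ; +_; -_; _⊖_)
  renaming (_+_ to _+ℤ_; _*_ to _*ℤ_; _-_ to _-ℤ_)
import Data.Integer.Properties as ℤ
open import Algebra.Properties.CommutativeSemigroup ℤ.+-commutativeSemigroup using (interchange)
open import Data.Sum using (inj₁; inj₂)
open import Data.Empty using (⊥-elim)
open import Function using (_∘_)
open import Relation.Binary.PropositionalEquality
import Data.Nat.Tactic.RingSolver as ℕ-Solver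
import Data.Integer.Tactic.RingSolver as ℤ-Solver

-- Finite sums of integers

∑ : ℕ → (ℕ → ℤ) → ℤ
∑ zero    f = + 0
∑ (suc n) f = ∑ n f +ℤ f n

∑-cong : ∀ n {f g : ℕ → ℤ} → (∀ j → j < n → f j ≡ g j) → ∑ n f ≡ ∑ n g
∑-cong zero    f≗g = refl
∑-cong (suc n) f≗g =
  cong₂ _+ℤ_ (∑-cong n (λ j j<n → f≗g j (m<n⇒m<1+n j<n))) (f≗g n ≤-refl)

∑-zero : ∀ n {f : ℕ → ℤ} → (∀ j → j < n → f j ≡ + 0) → ∑ n f ≡ + 0
∑-zero n f≗0 = trans (∑-cong n f≗0) (∑-const n)
  where
  ∑-const : ∀ n → ∑ n (λ _ → + 0) ≡ + 0
  ∑-const zero    = refl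
  ∑-const (suc n) = cong (_+ℤ + 0) (∑-const n)

∑-+ : ∀ n (f g : ℕ → ℤ) → ∑ n (λ j → f j +ℤ g j) ≡ ∑ n f +ℤ ∑ n g
∑-+ zero    f g = refl
∑-+ (suc n) f g =
  trans (cong (_+ℤ (f n +ℤ g n)) (∑-+ n f g)) (interchange (∑ n f) (∑ n g) (f n) (g n))

∑-suc : ∀ n (f : ℕ → ℤ) → ∑ (suc n) f ≡ f 0 +ℤ ∑ n (λ j → f (suc j))
∑-suc zero    f = ℤ.+-comm (+ 0) (f 0)
∑-suc (suc n) f = trans (cong (_+ℤ f (suc n)) (∑-suc n f)) (ℤ.+-assoc (f 0) _ _)

∑-extend : ∀ {a} b (f : ℕ → ℤ) → a ≤ b → (∀ j → a ≤ j → f j ≡ + 0) → ∑ b f ≡ ∑ a f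
∑-extend zero    f z≤n   f≗0 = refl
∑-extend (suc b) f a≤1+b f≗0 with m≤n⇒m<n∨m≡n a≤1+b
... | inj₁ a≤b = trans (cong₂ _+ℤ_ (∑-extend b f (m<1+n⇒m≤n a≤b) f≗0) (f≗0 b (m<1+n⇒m≤n a≤b)))
                       (ℤ.+-identityʳ _)
... | inj₂ refl = refl

∑-cut : ∀ a b (f : ℕ → ℤ) →
        (∀ j → a ≤ j → f j ≡ + 0) → (∀ j → b ≤ j → f j ≡ + 0) → ∑ a f ≡ ∑ b f
∑-cut a b f f≗0₁ f≗0₂ with ≤-total a b
... | inj₁ a≤b = sym (∑-extend b f a≤b f≗0₁)
... | inj₂ b≤a = ∑-extend a f b≤a f≗0₂

-- Binomial coefficients, Catalan and ballot numbers

pascal : ∀ n k → suc n C suc k ≡ n C k + n C suc k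
pascal n k = sym (nCk+nC[k+1]≡[n+1]C[k+1] n k)

C-sym : ∀ j k → (j + k) C j ≡ (j + k) C k
C-sym j k = trans (nCk≡nC[n∸k] (m≤m+n j k)) (cong ((j + k) C_) (m+n∸m≡n j k))

[1+k]*[1+n]C[1+k]≡[1+n]*nCk : ∀ n k → suc k * (suc n C suc k) ≡ suc n * (n C k)
[1+k]*[1+n]C[1+k]≡[1+n]*nCk zero    zero    = refl
[1+k]*[1+n]C[1+k]≡[1+n]*nCk zero    (suc k) = *-comm (suc (suc k)) 0
[1+k]*[1+n]C[1+k]≡[1+n]*nCk (suc n) zero    =
  trans (cong (_+ 0) (nC1≡n (suc (suc n)))) (*-comm 1 (suc (suc n)))
[1+k]*[1+n]C[1+k]≡[1+n]*nCk (suc n) (suc k) = begin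
  suc (suc k) * (suc (suc n) C suc (suc k))
    ≡⟨ cong (suc (suc k) *_) (pascal (suc n) (suc k)) ⟩
  suc (suc k) * (suc n C suc k + suc n C suc (suc k))
    ≡⟨ regroup k (suc n C suc k) (suc n C suc (suc k)) ⟩
  suc k * (suc n C suc k) + suc n C suc k + suc (suc k) * (suc n C suc (suc k))
    ≡⟨ cong₂ (λ a b → a + suc n C suc k + b) ([1+k]*[1+n]C[1+k]≡[1+n]*nCk n k)
                                              ([1+k]*[1+n]C[1+k]≡[1+n]*nCk n (suc k)) ⟩
  suc n * (n C k) + suc n C suc k + suc n * (n C suc k)
    ≡⟨ cong (λ a → suc n * (n C k) + a + suc n * (n C suc k)) (pascal n k) ⟩
  suc n * (n C k) + (n C k + n C suc k) + suc n * (n C suc k)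
    ≡⟨ collect n (n C k) (n C suc k) ⟩
  suc (suc n) * (n C k + n C suc k)
    ≡⟨ cong (suc (suc n) *_) (pascal n k) ⟨
  suc (suc n) * (suc n C suc k)
    ∎
  where
  open ≡-Reasoning
  regroup : ∀ k a b → suc (suc k) * (a + b) ≡ suc k * a + a + suc (suc k) * b
  regroup = ℕ-Solver.solve-∀
  collect : ∀ n a b → suc n * a + (a + b) + suc n * b ≡ suc (suc n) * (a + b)
  collect = ℕ-Solver.solve-∀

a/[1+n]≡a-b : ∀ n a b → n * a ≡ suc n * b → + (a / suc n) ≡ + a -ℤ + b
a/[1+n]≡a-b n a b n*a≡[1+n]*b = begin
  + (a / suc n)                 ≡⟨ cong (λ x → + (x / suc n)) a≡[a∸b]*[1+n] ⟩
  + ((a ∸ b) * suc n / suc n)   ≡⟨ cong +_ (m*n/n≡m (a ∸ b) (suc n)) ⟩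
  + (a ∸ b)                     ≡⟨ ℤ.⊖-≥ b≤a ⟨
  a ⊖ b                         ≡⟨ ℤ.m-n≡m⊖n a b ⟨
  + a -ℤ + b                    ∎
  where
  open ≡-Reasoning
  b≤a : b ≤ a
  b≤a = *-cancelˡ-≤ (suc n) (subst (_≤ suc n * a) n*a≡[1+n]*b (*-monoˡ-≤ a (n≤1+n n)))
  a≡[a∸b]*[1+n] : a ≡ (a ∸ b) * suc n
  a≡[a∸b]*[1+n] = sym (begin
    (a ∸ b) * suc n            ≡⟨ *-comm (a ∸ b) (suc n) ⟩
    suc n * (a ∸ b)            ≡⟨ *-distribˡ-∸ (suc n) a b ⟩
    suc n * a ∸ suc n * b      ≡⟨ cong (suc n * a ∸_) n*a≡[1+n]*b ⟨
    a + n * a ∸ n * a          ≡⟨ m+n∸n≡m a (n * a) ⟩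
    a                          ∎)

ballot : ℕ → ℕ → ℤ
ballot r zero    = + 1
ballot r (suc s) = + ((r + (s + suc s)) C suc s) -ℤ + ((r + (s + suc s)) C s)

catalan≡ballot₁ : ∀ t → + catalan (suc t) ≡ ballot 1 (suc t)
catalan≡ballot₁ t = trans (cong (λ n → + ((n C suc t) / suc (suc t))) (twice t))
                          (a/[1+n]≡a-b (suc t) (suc N C suc t) (suc N C t) central)
  where
  N = t + suc t
  twice : ∀ t → 2 * suc t ≡ suc (t + suc t)
  twice = ℕ-Solver.solve-∀
  flip : suc N C suc (suc t) ≡ suc N C t
  flip = subst (λ n → n C suc (suc t) ≡ n C t) (sym (cong suc (+-suc t t))) (C-sym (suc (suc t)) t)
  central : suc t * (suc N C suc t) ≡ suc (suc t) * (suc N C t)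
  central = begin
    suc t * (suc N C suc t)              ≡⟨ [1+k]*[1+n]C[1+k]≡[1+n]*nCk N t ⟩
    suc N * (N C t)                      ≡⟨ cong (suc N *_) (C-sym t (suc t)) ⟩
    suc N * (N C suc t)                  ≡⟨ [1+k]*[1+n]C[1+k]≡[1+n]*nCk N (suc t) ⟨
    suc (suc t) * (suc N C suc (suc t))  ≡⟨ cong (suc (suc t) *_) flip ⟩
    suc (suc t) * (suc N C t)            ∎
    where open ≡-Reasoning

ballot₀ : ∀ s → ballot 0 (suc s) ≡ + 0
ballot₀ s = ℤ.i≡j⇒i-j≡0 (cong +_ (sym (C-sym s (suc s))))

ballot-rec : ∀ r s → ballot r (suc s) ≡ ballot (suc r) (suc s) -ℤ ballot (suc (suc r)) s
ballot-rec r zero = begin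
  + ((r + 1) C 1) -ℤ + 1                ≡⟨ cong (λ n → + n -ℤ + 1) (nC1≡n (r + 1)) ⟩
  + (r + 1) -ℤ + 1                      ≡⟨ cancel (+ (r + 1)) ⟩
  ((+ 1 +ℤ + (r + 1)) -ℤ + 1) -ℤ + 1    ≡⟨ cong (λ x → (x -ℤ + 1) -ℤ + 1) (ℤ.pos-+ 1 (r + 1)) ⟨
  (+ (suc r + 1) -ℤ + 1) -ℤ + 1         ≡⟨ cong (λ n → (+ n -ℤ + 1) -ℤ + 1) (nC1≡n (suc r + 1)) ⟨
  (+ ((suc r + 1) C 1) -ℤ + 1) -ℤ + 1   ∎
  where
  open ≡-Reasoning
  cancel : ∀ x → x -ℤ + 1 ≡ ((+ 1 +ℤ x) -ℤ + 1) -ℤ + 1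
  cancel = ℤ-Solver.solve-∀
ballot-rec r (suc t) = begin
  + b -ℤ + a
    ≡⟨ regroup (+ a) (+ b) (+ c) ⟩
  (+ a +ℤ + b -ℤ (+ c +ℤ + a)) -ℤ (+ a -ℤ + c)
    ≡⟨ cong₂ (λ x y → (x -ℤ y) -ℤ (+ a -ℤ + c)) (ℤ.pos-+ a b) (ℤ.pos-+ c a) ⟨
  (+ (a + b) -ℤ + (c + a)) -ℤ (+ a -ℤ + c)
    ≡⟨ cong₂ (λ x y → (+ x -ℤ + y) -ℤ (+ a -ℤ + c)) (pascal N (suc t)) (pascal N t) ⟨
  ballot (suc r) (suc (suc t)) -ℤ (+ a -ℤ + c)
    ≡⟨ cong (λ n → ballot (suc r) (suc (suc t)) -ℤ (+ (n C suc t) -ℤ + (n C t))) (size r t) ⟩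
  ballot (suc r) (suc (suc t)) -ℤ ballot (suc (suc r)) (suc t)
    ∎
  where
  open ≡-Reasoning
  N = r + (suc t + suc (suc t))
  a = N C suc t
  b = N C suc (suc t)
  c = N C t
  regroup : ∀ a b c → b -ℤ a ≡ (a +ℤ b -ℤ (c +ℤ a)) -ℤ (a -ℤ c)
  regroup = ℤ-Solver.solve-∀
  size : ∀ r t → r + (suc t + suc (suc t)) ≡ suc (suc r) + (t + suc t)
  size = ℕ-Solver.solve-∀

catalan≡ballot₂ : ∀ s → + catalan (suc s) ≡ ballot 2 s
catalan≡ballot₂ s = trans (catalan≡ballot₁ s)
  (ℤ.i-j≡0⇒i≡j (ballot 1 (suc s)) (ballot 2 s) (trans (sym (ballot-rec 0 s)) (ballot₀ s)))

-- The congruence P_{m-1} · catalanSeries ≡ P_{m+1} (mod x^{m+1})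

catalanSeries : ℕ → ℤ
catalanSeries zero          = + 1
catalanSeries (suc zero)    = + 2
catalanSeries (suc (suc s)) = sgn (suc s) *ℤ + catalan (suc s)

-- Q m is the coefficient sequence of P_{m-1} (with P_{-1} = P_0 = 1), Q·c m that of
-- P_{m-1} · catalanSeries, and defect m s is the coefficient of x^{m+s} in Q·c m - P_{m+1}.
Q : ℕ → ℕ → ℤ
Q m j = + ((m ∸ j) C j)

Q·c : ℕ → ℕ → ℤ
Q·c m k = ∑ (suc k) (λ j → Q m j *ℤ (x^ j *ₚ catalanSeries) k)

defect : ℕ → ℕ → ℤ
defect m zero    = + 0
defect m (suc s) = sgn (m + s) *ℤ ballot (suc m) s

Q-rec : ∀ m k → Q (2 + m) (suc k) ≡ Q (suc m) (suc k) +ℤ Q m k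
Q-rec m k = trans (cong +_ pascal-∸) (ℤ.pos-+ ((m ∸ k) C suc k) ((m ∸ k) C k))
  where
  pascal-∸ : (suc m ∸ k) C suc k ≡ (m ∸ k) C suc k + (m ∸ k) C k
  pascal-∸ with ≤-<-connex k m
  ... | inj₁ k≤m = trans (cong (_C suc k) (+-∸-assoc 1 k≤m))
                         (trans (pascal (m ∸ k) k) (+-comm ((m ∸ k) C k) _))
  ... | inj₂ (s≤s m≤k′) rewrite m≤n⇒m∸n≡0 m≤k′ | m≤n⇒m∸n≡0 (m≤n⇒m≤1+n m≤k′) = refl

Q-vanish : ∀ n k → n < k + k → Q n k ≡ + 0
Q-vanish n (suc k) n<k+k = cong +_ (k>n⇒nCk≡0 (m<n+o⇒m∸n<o n (suc k) n<k+k))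

double-< : ∀ {a b} → a < b → 2 + a + a < suc b + suc b
double-< {a} {b} a<b = s≤s (≤-trans (s≤s (+-mono-< a<b a<b)) (≤-reflexive (sym (+-suc b b))))

Q·c-unfold : ∀ m k → Q·c m (suc k) ≡
  catalanSeries (suc k) +ℤ ∑ (suc k) (λ j → Q m (suc j) *ℤ (x^ j *ₚ catalanSeries) k)
Q·c-unfold m k = trans (∑-suc (suc k) (λ j → Q m j *ℤ (x^ j *ₚ catalanSeries) (suc k)))
                       (cong (_+ℤ ∑ (suc k) (λ j → Q m (suc j) *ℤ (x^ j *ₚ catalanSeries) k))
                             (ℤ.*-identityˡ (catalanSeries (suc k))))

Q·c-rec : ∀ m k → Q·c (2 + m) (suc k) ≡ Q·c (suc m) (suc k) +ℤ Q·c m k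
Q·c-rec m k = begin
  Q·c (2 + m) (suc k)
    ≡⟨ Q·c-unfold (2 + m) k ⟩
  c₁ +ℤ ∑ (suc k) (λ j → Q (2 + m) (suc j) *ℤ X j)
    ≡⟨ cong (c₁ +ℤ_) (∑-cong (suc k) (λ j _ → split j)) ⟩
  c₁ +ℤ ∑ (suc k) (λ j → Q (suc m) (suc j) *ℤ X j +ℤ Q m j *ℤ X j)
    ≡⟨ cong (c₁ +ℤ_) (∑-+ (suc k) _ _) ⟩
  c₁ +ℤ (∑ (suc k) (λ j → Q (suc m) (suc j) *ℤ X j) +ℤ Q·c m k)
    ≡⟨ ℤ.+-assoc c₁ _ (Q·c m k) ⟨
  (c₁ +ℤ ∑ (suc k) (λ j → Q (suc m) (suc j) *ℤ X j)) +ℤ Q·c m k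
    ≡⟨ cong (_+ℤ Q·c m k) (Q·c-unfold (suc m) k) ⟨
  Q·c (suc m) (suc k) +ℤ Q·c m k
    ∎
  where
  open ≡-Reasoning
  c₁ = catalanSeries (suc k)
  X : ℕ → ℤ
  X j = (x^ j *ₚ catalanSeries) k
  split : ∀ j → Q (2 + m) (suc j) *ℤ X j ≡ Q (suc m) (suc j) *ℤ X j +ℤ Q m j *ℤ X j
  split j = trans (cong (_*ℤ X j) (Q-rec m j)) (ℤ.*-distribʳ-+ (X j) (Q (suc m) (suc j)) (Q m j))

Q·c-small : ∀ {m} → m ≤ 1 → ∀ k → Q·c m k ≡ catalanSeries k
Q·c-small     m≤1 zero    = refl
Q·c-small {m} m≤1 (suc k) =
  trans (Q·c-unfold m k)
        (trans (cong (catalanSeries (suc k) +ℤ_) (∑-zero (suc k) (λ j _ → vanish j)))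
               (ℤ.+-identityʳ (catalanSeries (suc k))))
  where
  vanish : ∀ j → Q m (suc j) *ℤ (x^ j *ₚ catalanSeries) k ≡ + 0
  vanish j rewrite m≤n⇒m∸n≡0 (≤-trans m≤1 (s≤s (z≤n {j}))) = refl

Q·c-small-high : ∀ {m} → m ≤ 1 → ∀ s →
                 Q·c m (2 + s) ≡ Q (2 + m) (2 + s) +ℤ catalanSeries (2 + s)
Q·c-small-high {m} m≤1 s = begin
  Q·c m (2 + s)                              ≡⟨ Q·c-small m≤1 (2 + s) ⟩
  catalanSeries (2 + s)                      ≡⟨ ℤ.+-identityˡ (catalanSeries (2 + s)) ⟨
  + 0 +ℤ catalanSeries (2 + s)               ≡⟨ cong (_+ℤ catalanSeries (2 + s)) Q≡0 ⟨
  Q (2 + m) (2 + s) +ℤ catalanSeries (2 + s) ∎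
  where
  open ≡-Reasoning
  Q≡0 : Q (2 + m) (2 + s) ≡ + 0
  Q≡0 = Q-vanish (2 + m) (2 + s)
    (s≤s (s≤s (≤-trans (s≤s m≤1) (≤-trans (s≤s (s≤s z≤n)) (m≤n+m (2 + s) s)))))

defect-rec : ∀ m d → defect (2 + m) (pred d) ≡ defect (suc m) d +ℤ defect m d
defect-rec m zero          = refl
defect-rec m (suc zero)    = sym (cancel (sgn (m + 0)))
  where
  cancel : ∀ x → - x *ℤ + 1 +ℤ x *ℤ + 1 ≡ + 0
  cancel = ℤ-Solver.solve-∀
defect-rec m (suc (suc s)) = begin
  - - sgn (m + s) *ℤ B₃      ≡⟨ cong (λ x → - x *ℤ B₃) (cong sgn (+-suc m s)) ⟨
  - σ *ℤ B₃                  ≡⟨ expand σ B₂ B₃ ⟩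
  - σ *ℤ B₂ +ℤ σ *ℤ (B₂ -ℤ B₃) ≡⟨ cong (λ b → - σ *ℤ B₂ +ℤ σ *ℤ b) (ballot-rec (suc m) s) ⟨
  - σ *ℤ B₂ +ℤ σ *ℤ ballot (suc m) (suc s) ∎
  where
  open ≡-Reasoning
  σ = sgn (m + suc s)
  B₂ = ballot (2 + m) (suc s)
  B₃ = ballot (3 + m) s
  expand : ∀ y b₂ b₃ → - y *ℤ b₃ ≡ - y *ℤ b₂ +ℤ y *ℤ (b₂ -ℤ b₃)
  expand = ℤ-Solver.solve-∀

Q·c≡Q+defect : ∀ m k → Q·c m k ≡ Q (2 + m) k +ℤ defect m (k ∸ m)
Q·c≡Q+defect zero          zero          = refl
Q·c≡Q+defect zero          (suc zero)    = refl
Q·c≡Q+defect zero          (suc (suc s)) = trans (Q·c-small-high z≤n s)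
  (cong (λ b → Q 2 (2 + s) +ℤ sgn (suc s) *ℤ b) (catalan≡ballot₁ s))
Q·c≡Q+defect (suc zero)    zero          = refl
Q·c≡Q+defect (suc zero)    (suc zero)    = refl
Q·c≡Q+defect (suc zero)    (suc (suc s)) = trans (Q·c-small-high (s≤s z≤n) s)
  (cong (λ b → Q 3 (2 + s) +ℤ sgn (suc s) *ℤ b) (catalan≡ballot₂ s))
Q·c≡Q+defect (suc (suc m)) zero          = refl
Q·c≡Q+defect (suc (suc m)) (suc k)       = begin
  Q·c (2 + m) (suc k)
    ≡⟨ Q·c-rec m k ⟩
  Q·c (suc m) (suc k) +ℤ Q·c m k
    ≡⟨ cong₂ _+ℤ_ (Q·c≡Q+defect (suc m) (suc k)) (Q·c≡Q+defect m k) ⟩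
  (Q (3 + m) (suc k) +ℤ defect (suc m) (k ∸ m)) +ℤ (Q (2 + m) k +ℤ defect m (k ∸ m))
    ≡⟨ interchange (Q (3 + m) (suc k)) (defect (suc m) (k ∸ m)) (Q (2 + m) k) (defect m (k ∸ m)) ⟩
  (Q (3 + m) (suc k) +ℤ Q (2 + m) k) +ℤ (defect (suc m) (k ∸ m) +ℤ defect m (k ∸ m))
    ≡⟨ cong₂ _+ℤ_ (Q-rec (2 + m) k) (defect-rec m (k ∸ m)) ⟨
  Q (4 + m) (suc k) +ℤ defect (2 + m) (pred (k ∸ m))
    ≡⟨ cong (λ d → Q (4 + m) (suc k) +ℤ defect (2 + m) d) (pred[m∸n]≡m∸[1+n] k m) ⟩
  Q (4 + m) (suc k) +ℤ defect (2 + m) (k ∸ suc m)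
    ∎
  where open ≡-Reasoning

Q·c≡Q : ∀ {m k} → k ≤ m → Q·c m k ≡ Q (2 + m) k
Q·c≡Q {m} {k} k≤m = begin
  Q·c m k                          ≡⟨ Q·c≡Q+defect m k ⟩
  Q (2 + m) k +ℤ defect m (k ∸ m)  ≡⟨ cong (λ d → Q (2 + m) k +ℤ defect m d) (m≤n⇒m∸n≡0 k≤m) ⟩
  Q (2 + m) k +ℤ + 0               ≡⟨ ℤ.+-identityʳ (Q (2 + m) k) ⟩
  Q (2 + m) k                      ∎
  where open ≡-Reasoning

-- Coefficients of the polynomials in the statement

Σₚ-coeff : ∀ n (f : ℕ → Poly) i → Σₚ n f i ≡ ∑ n (λ j → f j i)
Σₚ-coeff zero    f i = refl
Σₚ-coeff (suc n) f i = cong (_+ℤ f n i) (Σₚ-coeff n f i)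

X^-self : ∀ k → X^ k k ≡ + 1
X^-self zero    = refl
X^-self (suc k) = X^-self k

X^-other : ∀ {j k} → j ≢ k → X^ k j ≡ + 0
X^-other {zero}  {zero}  j≢k = ⊥-elim (j≢k refl)
X^-other {zero}  {suc k} j≢k = refl
X^-other {suc j} {zero}  j≢k = refl
X^-other {suc j} {suc k} j≢k = X^-other (j≢k ∘ cong suc)

X^-comm : ∀ j k → X^ j k ≡ X^ k j
X^-comm zero    zero    = refl
X^-comm zero    (suc k) = refl
X^-comm (suc j) zero    = refl
X^-comm (suc j) (suc k) = X^-comm j k

∑-X^-select : ∀ {k n} (f : ℕ → ℤ) → k < n → ∑ n (λ j → X^ k j *ℤ f j) ≡ f k
∑-X^-select {k} {n} f k<n = begin
  ∑ n g                  ≡⟨ ∑-extend n g k<n (λ j k<j → off (<⇒≢ k<j ∘ sym)) ⟩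
  ∑ k g +ℤ g k           ≡⟨ cong (_+ℤ g k) (∑-zero k (λ j j<k → off (<⇒≢ j<k))) ⟩
  + 0 +ℤ X^ k k *ℤ f k   ≡⟨ ℤ.+-identityˡ (X^ k k *ℤ f k) ⟩
  X^ k k *ℤ f k          ≡⟨ cong (_*ℤ f k) (X^-self k) ⟩
  + 1 *ℤ f k             ≡⟨ ℤ.*-identityˡ (f k) ⟩
  f k                    ∎
  where
  open ≡-Reasoning
  g : ℕ → ℤ
  g j = X^ k j *ℤ f j
  off : ∀ {j} → j ≢ k → g j ≡ + 0
  off {j} j≢k = trans (cong (_*ℤ f j) (X^-other j≢k)) (ℤ.*-zeroˡ (f j))

∑-X^-beyond : ∀ {k n} (f : ℕ → ℤ) → n ≤ k → ∑ n (λ j → X^ k j *ℤ f j) ≡ + 0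
∑-X^-beyond {k} f n≤k = ∑-zero _ (λ j j<n →
  trans (cong (_*ℤ f j) (X^-other (<⇒≢ (<-≤-trans j<n n≤k)))) (ℤ.*-zeroˡ (f j)))

xₚ*-cong : ∀ {p q : Poly} → (∀ i → p i ≡ q i) → ∀ i → xₚ* p i ≡ xₚ* q i
xₚ*-cong p≗q zero    = refl
xₚ*-cong p≗q (suc i) = p≗q i

x^-*-cong : ∀ j {p q : Poly} → (∀ i → p i ≡ q i) →
            ∀ i → (x^ j *ₚ p) i ≡ (x^ j *ₚ q) i
x^-*-cong zero    p≗q = p≗q
x^-*-cong (suc j) p≗q = xₚ*-cong (x^-*-cong j p≗q)

x^-*-below : ∀ j (p : Poly) {i} → i < j → (x^ j *ₚ p) i ≡ + 0
x^-*-below (suc j) p {zero}  i<j       = refl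
x^-*-below (suc j) p {suc i} (s≤s i<j) = x^-*-below j p i<j

x^-*-agree : ∀ j {p q : Poly} {n} → (∀ i → i ≤ n → p i ≡ q i) →
             ∀ i → i ≤ j + n → (x^ j *ₚ p) i ≡ (x^ j *ₚ q) i
x^-*-agree zero    p≗q i       i≤n         = p≗q i i≤n
x^-*-agree (suc j) p≗q zero    _           = refl
x^-*-agree (suc j) p≗q (suc i) (s≤s i≤j+n) = x^-*-agree j p≗q i i≤j+n

x^-*-vanish : ∀ j {p : Poly} {n} → (∀ i → n ≤ i → p i ≡ + 0) →
              ∀ i → j + n ≤ i → (x^ j *ₚ p) i ≡ + 0
x^-*-vanish zero    p≗0 i       n≤i         = p≗0 i n≤i
x^-*-vanish (suc j) p≗0 (suc i) (s≤s j+n≤i) = x^-*-vanish j p≗0 i j+n≤i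

A-monomial : ∀ {d k} → k ≤ d → ∀ i → A d (X^ k) i ≡ Aimg d k i
A-monomial {d} {k} k≤d i = trans (Σₚ-coeff (suc d) (λ j → X^ k j ·ₚ Aimg d j) i)
                                 (∑-X^-select (λ j → Aimg d j i) (s≤s k≤d))

Aimg-monomial : ∀ {d k} → k ≤ d → ∀ i → Aimg d k i ≡ (x^ k *ₚ Aimg (d ∸ k) 0) i
Aimg-monomial {d}     {zero}  _         i = refl
Aimg-monomial {suc d} {suc k} (s≤s k≤d) i =
  xₚ*-cong (λ i → trans (A-monomial k≤d i) (Aimg-monomial k≤d i)) i

rhs₀-coeff : ∀ e i → rhs e 0 i ≡
  X^ 0 i +ℤ (+ 2 *ℤ X^ 1 i +ℤ ∑ e (λ j → X^ i (2 + j) *ℤ catalanSeries (2 + j)))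
rhs₀-coeff e i = cong (λ x → X^ 0 i +ℤ (+ 2 *ℤ X^ 1 i +ℤ x))
  (trans (Σₚ-coeff e (λ j → catalanSeries (2 + j) ·ₚ X^ (2 + j)) i)
         (∑-cong e (λ j _ → trans (ℤ.*-comm (catalanSeries (2 + j)) (X^ (2 + j) i))
                                  (cong (_*ℤ catalanSeries (2 + j)) (X^-comm (2 + j) i)))))

rhs₀-low : ∀ e {i} → i ≤ suc e → rhs e 0 i ≡ catalanSeries i
rhs₀-low e {zero}        _ = trans (rhs₀-coeff e 0)
  (cong (λ x → + 1 +ℤ (+ 0 +ℤ x)) (∑-zero e (λ j _ → ℤ.*-zeroˡ (catalanSeries (2 + j)))))
rhs₀-low e {suc zero}    _ = trans (rhs₀-coeff e 1)
  (cong (λ x → + 0 +ℤ (+ 2 +ℤ x)) (∑-zero e (λ j _ → ℤ.*-zeroˡ (catalanSeries (2 + j)))))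
rhs₀-low e {suc (suc s)} (s≤s s<e) = trans (rhs₀-coeff e (2 + s))
  (trans (ℤ.+-identityˡ _)
  (trans (ℤ.+-identityˡ _) (∑-X^-select (λ j → catalanSeries (2 + j)) s<e)))

rhs₀-high : ∀ e {i} → 2 + e ≤ i → rhs e 0 i ≡ + 0
rhs₀-high e {suc (suc s)} (s≤s (s≤s e≤s)) = trans (rhs₀-coeff e (2 + s))
  (trans (ℤ.+-identityˡ _)
  (trans (ℤ.+-identityˡ _) (∑-X^-beyond (λ j → catalanSeries (2 + j)) e≤s)))

Aimg-suc-zero : ∀ e t → Aimg (suc e) 0 (suc t) ≡
  Q (4 + e + e) (suc t) -ℤ ∑ (suc e) (λ j → Q (2 + e + e) (suc j) *ℤ Aimg e j t)
Aimg-suc-zero e t = cong₂ _-ℤ_ (cong (λ n → + ((n ∸ suc t) C suc t)) (size₁ e))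
  (trans (Σₚ-coeff (suc e) (λ j → q j ·ₚ Aimg e j) t)
         (∑-cong (suc e) (λ j _ → cong (_*ℤ Aimg e j t) (q≡Q j))))
  where
  size₁ : ∀ e → 2 * suc e + 1 + 1 ≡ 4 + e + e
  size₁ = ℕ-Solver.solve-∀
  size₂ : ∀ e → 2 * suc e ≡ 2 + e + e
  size₂ = ℕ-Solver.solve-∀
  q : ℕ → ℤ
  q i = (P (2 * suc e ∸ 1) -ₚ X^ 0) (suc i)
  q≡Q : ∀ j → q j ≡ Q (2 + e + e) (suc j)
  q≡Q j = trans (ℤ.+-identityʳ _)
    (cong (λ n → + ((n ∸ suc j) C suc j)) (trans (m∸n+n≡m (s≤s z≤n)) (size₂ e)))

module A-one-step (e : ℕ) (ih : ∀ j i → Aimg (e ∸ j) 0 i ≡ rhs (e ∸ j) 0 i) where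

  m : ℕ
  m = 2 + e + e

  Aimg-via-ih : ∀ {j} → j ≤ e → ∀ t → Aimg e j t ≡ (x^ j *ₚ rhs (e ∸ j) 0) t
  Aimg-via-ih {j} j≤e t = trans (Aimg-monomial j≤e t) (x^-*-cong j (ih j) t)

  Aimg-low : ∀ {j t} → j ≤ e → t ≤ suc e → Aimg e j t ≡ (x^ j *ₚ catalanSeries) t
  Aimg-low {j} {t} j≤e t≤1+e = trans (Aimg-via-ih j≤e t)
    (x^-*-agree j (λ i → rhs₀-low (e ∸ j)) t (subst (t ≤_) (sym j+[1+e∸j]≡1+e) t≤1+e))
    where
    j+[1+e∸j]≡1+e : j + suc (e ∸ j) ≡ suc e
    j+[1+e∸j]≡1+e = trans (+-suc j (e ∸ j)) (cong suc (m+[n∸m]≡n j≤e))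

  Aimg-high : ∀ {j t} → j ≤ e → 2 + e ≤ t → Aimg e j t ≡ + 0
  Aimg-high {j} {t} j≤e 2+e≤t = trans (Aimg-via-ih j≤e t)
    (x^-*-vanish j (λ i → rhs₀-high (e ∸ j)) t (subst (_≤ t) (sym j+[2+e∸j]≡2+e) 2+e≤t))
    where
    j+[2+e∸j]≡2+e : j + (2 + (e ∸ j)) ≡ 2 + e
    j+[2+e∸j]≡2+e =
      trans (+-suc j _) (cong suc (trans (+-suc j (e ∸ j)) (cong suc (m+[n∸m]≡n j≤e))))

  low : ∀ {t} → t ≤ suc e → Aimg (suc e) 0 (suc t) ≡ catalanSeries (suc t)
  low {t} t≤1+e = begin
    Aimg (suc e) 0 (suc t)
      ≡⟨ Aimg-suc-zero e t ⟩
    Q (2 + m) (suc t) -ℤ ∑ (suc e) (λ j → Q m (suc j) *ℤ Aimg e j t)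
      ≡⟨ cong₂ _-ℤ_ (Q·c≡Q 1+t≤m) (∑-cong (suc e) (λ j j<1+e → cong (Q m (suc j) *ℤ_)
                                     (sym (Aimg-low (m<1+n⇒m≤n j<1+e) t≤1+e)))) ⟨
    Q·c m (suc t) -ℤ ∑ (suc e) f
      ≡⟨ cong (_-ℤ ∑ (suc e) f) (Q·c-unfold m t) ⟩
    (catalanSeries (suc t) +ℤ ∑ (suc t) f) -ℤ ∑ (suc e) f
      ≡⟨ cong (λ x → (catalanSeries (suc t) +ℤ x) -ℤ ∑ (suc e) f)
              (∑-cut (suc t) (suc e) f beyond-t beyond-e) ⟩
    (catalanSeries (suc t) +ℤ ∑ (suc e) f) -ℤ ∑ (suc e) f
      ≡⟨ cancel (catalanSeries (suc t)) (∑ (suc e) f) ⟩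
    catalanSeries (suc t)
      ∎
    where
    open ≡-Reasoning
    f : ℕ → ℤ
    f j = Q m (suc j) *ℤ (x^ j *ₚ catalanSeries) t
    1+t≤m : suc t ≤ m
    1+t≤m = s≤s (≤-trans t≤1+e (s≤s (m≤m+n e e)))
    beyond-t : ∀ j → suc t ≤ j → f j ≡ + 0
    beyond-t j t<j = trans (cong (Q m (suc j) *ℤ_) (x^-*-below j catalanSeries t<j))
                           (ℤ.*-zeroʳ (Q m (suc j)))
    beyond-e : ∀ j → suc e ≤ j → f j ≡ + 0
    beyond-e j e<j = trans (cong (_*ℤ (x^ j *ₚ catalanSeries) t) (Q-vanish m (suc j) (double-< e<j)))
                           (ℤ.*-zeroˡ ((x^ j *ₚ catalanSeries) t))
    cancel : ∀ a b → (a +ℤ b) -ℤ b ≡ a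
    cancel = ℤ-Solver.solve-∀

  high : ∀ {t} → suc e < t → Aimg (suc e) 0 (suc t) ≡ + 0
  high {t} 1+e<t = trans (Aimg-suc-zero e t) (cong₂ _-ℤ_
    (Q-vanish (2 + m) (suc t) (subst (_< suc t + suc t) (size e) (double-< 1+e<t)))
    (∑-zero (suc e) (λ j j<1+e →
      trans (cong (Q m (suc j) *ℤ_) (Aimg-high (m<1+n⇒m≤n j<1+e) 1+e<t)) (ℤ.*-zeroʳ (Q m (suc j))))))
    where
    size : ∀ e → 2 + suc e + suc e ≡ 4 + e + e
    size = ℕ-Solver.solve-∀

  A-one-suc : ∀ i → Aimg (suc e) 0 i ≡ rhs (suc e) 0 i
  A-one-suc zero = sym (rhs₀-low (suc e) z≤n)
  A-one-suc (suc t) with ≤-<-connex t (suc e)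
  ... | inj₁ t≤1+e = trans (low t≤1+e) (sym (rhs₀-low (suc e) (s≤s t≤1+e)))
  ... | inj₂ 1+e<t = trans (high 1+e<t) (sym (rhs₀-high (suc e) (s≤s 1+e<t)))

A-one : ∀ e i → Aimg e 0 i ≡ rhs e 0 i
A-one = <-rec (λ e → ∀ i → Aimg e 0 i ≡ rhs e 0 i) λ where
  zero    _  i → cong (X^ 0 i +ℤ_) (sym (ℤ.+-identityʳ (+ 2 *ℤ X^ 1 i)))
  (suc e) ih → A-one-step.A-one-suc e (λ j → ih (s≤s (m∸n≤m e j)))

proposition4p6 : (d k : ℕ) → 1 ≤ k → k ≤ d →
    (i : ℕ) → A d (X^ k) i ≡ rhs d k i
proposition4p6 d k _ k≤d i = begin
  A d (X^ k) i                ≡⟨ A-monomial k≤d i ⟩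
  Aimg d k i                  ≡⟨ Aimg-monomial k≤d i ⟩
  (x^ k *ₚ Aimg (d ∸ k) 0) i  ≡⟨ x^-*-cong k (A-one (d ∸ k)) i ⟩
  (x^ k *ₚ rhs (d ∸ k) 0) i   ∎
  where open ≡-Reasoning
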